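{- Let $G$ be a graph with $n=n(G)$ vertices, $s=\mathrm{sg}(G)$, and diameter $d=\mathrm{diam}(G)\ge 2$. Then $$1\le \left\lceil s - \frac{1+\sqrt{(2s-1)^2-\frac{8(n-s)}{d-1}}}{2} \right\rceil \le \mathrm{sgc}(G) \le \min\{s - 1, n - s\}.$$
   Context: Graphs are finite and simple; strong geodetic notions are considered for connected graphs. For a graph $G$ and $S\subseteq V(G)$, one fixes for each unordered pair $\{x,y\}$ of distinct vertices of $S$ a single shortest $x,y$-path $\widetilde g(x,y)$; $S$ is a strong geodetic set if for some such choice the union of the vertex sets of the chosen paths equals $V(G)$. $\mathrm{sg}(G)$ is the minimum size of a strong geodetic set; a minimum one is an sg-set. For a strong geodetic set $S$, a set $X\subseteq S$ is a strong geodetic core for $S$ if there exists a choice of fixed shortest paths $\widetilde g(x,y)$ for pairs of $S$ such that $\bigcup_{(u,v)\in X\times S} V(\widetilde g(u,v)) = V(G)$. $\mathrm{sgc}(S)$ is the minimum size of a strong geodetic core for $S$, and $\mathrm{sgc}(G)=\min\{\mathrm{sgc}(S): S \text{ an sg-set of } G\}$. -}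

module Defs where

open import Data.Nat as ℕ using (ℕ; zero; suc)
open import Data.Integer as ℤ using (ℤ; +_)
open import Data.Fin using (Fin)
open import Data.Fin.Subset using (Subset; _∈_; _⊆_; ∣_∣)
open import Data.List using (List; []; _∷_; reverse)
import Data.List.Membership.Propositional as LM
open import Data.Product using (Σ; ∃; ∃-syntax; _×_)
open import Data.Sum using (_⊎_)
open import Relation.Binary.PropositionalEquality using (_≡_; _≢_)
open import Relation.Nullary using (¬_)

record Graph (n : ℕ) : Set₁ where
  field
    Adj       : Fin n → Fin n → Set
    Adj-sym   : ∀ {x y} → Adj x y → Adj y x
    Adj-irrefl : ∀ {x} → ¬ Adj x x
open Graph public

module _ {n : ℕ} (G : Graph n) where

  data Walk : Fin n → Fin n → ℕ → Set where
    stop : ∀ x → Walk x x 0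
    step : ∀ {x y z k} → Adj G x y → Walk y z k → Walk x z (suc k)

  verts : ∀ {x y k} → Walk x y k → List (Fin n)
  verts (stop x) = x ∷ []
  verts (step {x} _ w) = x ∷ verts w

  Connected : Set
  Connected = ∀ x y → ∃[ k ] Walk x y k

  record Geodesic (x y : Fin n) : Set where
    constructor geo
    field
      len      : ℕ
      walk     : Walk x y len
      shortest : ∀ m → Walk x y m → len ℕ.≤ m
  open Geodesic public

  Dist : Fin n → Fin n → ℕ → Set
  Dist x y k = Σ (Walk x y k) λ _ → ∀ m → Walk x y m → k ℕ.≤ m

  Diam : ℕ → Set
  Diam d = (∀ x y → ∃[ k ] (k ℕ.≤ d × Dist x y k)) × (∃[ x ] ∃[ y ] Dist x y d)

  -- A choice of one fixed shortest path for every unordered pair of S: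
  -- a shortest path for each ordered pair, with g(y,x) the reverse of g(x,y).
  record PathChoice (S : Subset n) : Set where
    field
      g   : ∀ x y → x ∈ S → y ∈ S → Geodesic x y
      sym : ∀ x y (px : x ∈ S) (py : y ∈ S) →
            verts (walk (g y x py px)) ≡ reverse (verts (walk (g x y px py)))
  open PathChoice public

  Covers : (S X : Subset n) → X ⊆ S → PathChoice S → Set
  Covers S X X⊆S P = ∀ w → ∃[ u ] ∃[ v ] Σ (u ∈ X) λ pu → Σ (v ∈ S) λ pv →
                       (u ≢ v) × (w LM.∈ verts (walk (g P u v (X⊆S pu) pv)))

  StrongGeodetic : Subset n → Set
  StrongGeodetic S = Σ (PathChoice S) λ P → Covers S S (λ p → p) P

  IsSgSet : Subset n → Set
  IsSgSet S = StrongGeodetic S × (∀ T → StrongGeodetic T → ∣ S ∣ ℕ.≤ ∣ T ∣)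

  SG : ℕ → Set
  SG s = (∃[ S ] (IsSgSet S × ∣ S ∣ ≡ s)) × (∀ S → StrongGeodetic S → s ℕ.≤ ∣ S ∣)

  IsCore : Subset n → Subset n → Set
  IsCore S X = Σ (X ⊆ S) λ X⊆S → Σ (PathChoice S) λ P → Covers S X X⊆S P

  SGC : ℕ → Set
  SGC c = (∃[ S ] ∃[ X ] (IsSgSet S × IsCore S X × ∣ X ∣ ≡ c))
        × (∀ S X → IsSgSet S → IsCore S X → c ℕ.≤ ∣ X ∣)

-- Arithmetic of the bound.  With D = (2s-1)^2 - 8(n-s)/(d-1) and d ≥ 2,
-- put D' = (d-1)·D = (d-1)(2s-1)^2 - 8(n-s) ∈ ℤ.
D' : ℕ → ℕ → ℕ → ℤ
D' s n d = (+ (d ℕ.∸ 1)) ℤ.* ((+ (2 ℕ.* s) ℤ.- + 1) ℤ.* (+ (2 ℕ.* s) ℤ.- + 1))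
           ℤ.- (+ 8) ℤ.* (+ n ℤ.- + s)

-- For an integer x:  x ≤ √D  (D ≥ 0), i.e. x < 0 or x² ≤ D, i.e. (d-1)x² ≤ D'.
LeSqrtD : ℕ → ℕ → ℕ → ℤ → Set
LeSqrtD s n d x = (x ℤ.< + 0) ⊎ ((+ (d ℕ.∸ 1)) ℤ.* (x ℤ.* x) ℤ.≤ D' s n d)

-- c = ⌈ s - (1 + √D)/2 ⌉ : D ≥ 0 (so the expression is defined) and c is the
-- least integer with s - (1+√D)/2 ≤ c, i.e. 2s - 2c - 1 ≤ √D.
-- (Monotonicity in c makes "c works, c-1 does not" equivalent to leastness.)
IsCeilBound : ℕ → ℕ → ℕ → ℤ → Set
IsCeilBound s n d c =
  (+ 0 ℤ.≤ D' s n d)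
  × LeSqrtD s n d (+ (2 ℕ.* s) ℤ.- (+ 2) ℤ.* c ℤ.- + 1)
  × ¬ LeSqrtD s n d (+ (2 ℕ.* s) ℤ.- (+ 2) ℤ.* (c ℤ.- + 1) ℤ.- + 1)

module Submission where

-- Fix an sg-set S, a core X of S with |X| = c, and the chosen paths g(u,v).
-- * s < n: an interior vertex z of a diametral geodesic can be dropped, V - z being
--   strong geodetic (sg<n).
-- * c < s: S minus any vertex is still a core of S, as g(v,u) is g(u,v) reversed (drop-one-core).
-- * c ≤ n - s: the first ends of the paths covering the vertices outside S form a core
--   of size at most n - s (image-core).
-- * Every vertex outside S is interior to some g(u,v) with u ∈ X; weighting the pairs
--   and double counting gives 2(n-s) ≤ c((s-1)+(s-c))(d-1) (Counting.count).
-- * By the identity (2s-1)² - (2s-2k-1)² = 4k(2s-1-k), this inequality means 2s-2c-1 ≤ √D,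
--   while 2s-1 > √D because n > s; so the ceiling, the least k with 2s-2k-1 ≤ √D, lies in
--   [1, c] (ceiling-bound).

open import Defs
open import Data.Nat using (ℕ; _≤_; _+_)
open import Data.Integer as ℤ using (ℤ; +_)
open import Data.Product using (∃-syntax; _×_)

open import Data.Bool using (if_then_else_)
open import Data.Bool.Properties using (T-≡)
open import Data.Empty using (⊥; ⊥-elim)
open import Data.Fin using (Fin; zero; suc)
import Data.Fin.Properties as Fin
open import Data.Fin.Subset using (Subset; inside; outside; _∈_; _∉_; _⊆_; _─_; _-_; ∁; ⁅_⁆; ∣_∣)
open import Data.Fin.Subset.Properties
  using (_∈?_; drop-∷-⊆; x∈⁅y⁆⇔x≡y; x∈⁅y⁆⇒x≡y; ∣⁅x⁆∣≡1; x∈∁p⇒x∉p; x∉p⇒x∈∁p; x≢y⇒x∉⁅y⁆; ∣∁p∣≡n∸∣p∣;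
         p─q⊆p; x∈p∧x≢y⇒x∈p-y; x∈p∧x∉q⇒x∈p─q; x∈p⇒∣p-x∣<∣p∣; nonempty?; Empty-unique; ∣⊥∣≡0)
import Data.Integer.Properties as ℤP
open import Data.Integer.Tactic.RingSolver using (solve-∀)
open import Data.List using (List; []; _∷_; _∷ʳ_; reverse; length)
open import Data.List.Membership.Propositional using () renaming (_∈_ to _∈ₗ_)
open import Data.List.Properties using (unfold-reverse; reverse-involutive)
open import Data.List.Relation.Unary.Any using (here; there; any?)
open import Data.List.Relation.Unary.Any.Properties using (reverse⁺)
open import Data.Nat using (zero; suc; _<_; _*_; _∸_; z≤n; s≤s)
open import Data.Nat.Properties
  using (module ≤-Reasoning; ≤-refl; ≤-trans; ≤-reflexive; ≤-antisym; <-≤-trans; <⇒≤; n≮n; +-comm; +-suc;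
         +-mono-≤; +-monoʳ-≤; +-monoˡ-≤; *-monoʳ-≤; *-identityˡ; *-identityʳ; *-zeroʳ; m≤m+n; m≤n+m;
         m≤n⇒m≤1+n; m+n∸n≡m; m∸n+n≡m; ∸-monoˡ-≤; m<n⇒0<n∸m; +-*-semiring)
open import Algebra.Properties.Semiring.Sum +-*-semiring
  using (sum; sum-syntax; sum-replicate-zero; ∑-comm; ∑-distrib-+; *-distribˡ-sum; *-distribʳ-sum; sum-cong-≗)
open import Data.Product using (_,_; proj₁; proj₂)
open import Data.Sum using (_⊎_; inj₁; inj₂; [_,_]; map₂)
open import Data.Vec using ([]; _∷_; tabulate)
import Data.Vec.Base as Vec
open import Data.Vec.Properties using (lookup⇒[]=; []=⇒lookup; lookup∘tabulate)
open import Function using (_⇔_; Equivalence)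
open import Function.Properties.Equivalence using () renaming (sym to ⇔-sym)
open import Relation.Binary.PropositionalEquality
  using (_≡_; _≢_; ≢-sym; refl; cong; cong₂; trans; subst; subst₂; module ≡-Reasoning)
import Relation.Binary.PropositionalEquality as ≡
open import Relation.Nullary using (Dec; yes; no; does; ¬_; contradiction)
open import Relation.Nullary.Decidable using (isYes; fromWitness; toWitness; _×-dec_; _⊎-dec_)
open import Relation.Unary using (Decidable)

𝟙 : {P : Set} → Dec P → ℕ
𝟙 d = if does d then 1 else 0

𝟙-yes : {P : Set} (d : Dec P) → P → 𝟙 d ≡ 1
𝟙-yes (yes _) _ = refl
𝟙-yes (no ¬p) p = contradiction p ¬p

𝟙-no : {P : Set} (d : Dec P) → ¬ P → 𝟙 d ≡ 0
𝟙-no (yes p) ¬p = contradiction p ¬p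
𝟙-no (no _) _ = refl

𝟙-cong : {P Q : Set} → P ⇔ Q → (p : Dec P) (q : Dec Q) → 𝟙 p ≡ 𝟙 q
𝟙-cong P⇔Q (yes p) q = ≡.sym (𝟙-yes q (Equivalence.to P⇔Q p))
𝟙-cong P⇔Q (no ¬p) q = ≡.sym (𝟙-no q (λ q′ → ¬p (Equivalence.from P⇔Q q′)))

sum-mono : ∀ {n} {f g : Fin n → ℕ} → (∀ i → f i ≤ g i) → sum f ≤ sum g
sum-mono {zero} f≤g = z≤n
sum-mono {suc n} f≤g = +-mono-≤ (f≤g zero) (sum-mono (λ i → f≤g (suc i)))

summand≤sum : ∀ {n} (f : Fin n → ℕ) i → f i ≤ sum f
summand≤sum f zero = m≤m+n _ _
summand≤sum f (suc i) = ≤-trans (summand≤sum (λ j → f (suc j)) i) (m≤n+m _ _)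

two-summands≤sum : ∀ {n} (f : Fin n → ℕ) {i j} → i ≢ j → f i + f j ≤ sum f
two-summands≤sum f {zero} {zero} i≢j = contradiction refl i≢j
two-summands≤sum f {zero} {suc j} _ = +-monoʳ-≤ (f zero) (summand≤sum (λ k → f (suc k)) j)
two-summands≤sum f {suc i} {zero} _ =
  subst (_≤ sum f) (+-comm (f zero) (f (suc i))) (+-monoʳ-≤ (f zero) (summand≤sum (λ k → f (suc k)) i))
two-summands≤sum f {suc i} {suc j} i≢j =
  ≤-trans (two-summands≤sum (λ k → f (suc k)) (λ i≡j → i≢j (cong suc i≡j))) (m≤n+m _ _)

∣∣≡∑ : ∀ {n} (p : Subset n) → ∣ p ∣ ≡ ∑[ i < n ] 𝟙 (i ∈? p)
∣∣≡∑ [] = refl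
∣∣≡∑ (inside ∷ p) = cong suc (∣∣≡∑ p)
∣∣≡∑ (outside ∷ p) = ∣∣≡∑ p

∑-≡-indicator : ∀ {n} (a : Fin n) → ∑[ i < n ] 𝟙 (i Fin.≟ a) ≡ 1
∑-≡-indicator {n} a = begin
  ∑[ i < n ] 𝟙 (i Fin.≟ a)   ≡⟨ sum-cong-≗ (λ i → 𝟙-cong (⇔-sym x∈⁅y⁆⇔x≡y) (i Fin.≟ a) (i ∈? ⁅ a ⁆)) ⟩
  ∑[ i < n ] 𝟙 (i ∈? ⁅ a ⁆)  ≡⟨ ≡.sym (∣∣≡∑ ⁅ a ⁆) ⟩
  ∣ ⁅ a ⁆ ∣                   ≡⟨ ∣⁅x⁆∣≡1 a ⟩
  1                          ∎
  where
  open ≡-Reasoning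

∣p─q∣+∣q∣ : ∀ {n} (p q : Subset n) → q ⊆ p → ∣ p ─ q ∣ + ∣ q ∣ ≡ ∣ p ∣
∣p─q∣+∣q∣ [] [] _ = refl
∣p─q∣+∣q∣ (inside ∷ p) (outside ∷ q) q⊆p = cong suc (∣p─q∣+∣q∣ p q (drop-∷-⊆ q⊆p))
∣p─q∣+∣q∣ (outside ∷ p) (outside ∷ q) q⊆p = ∣p─q∣+∣q∣ p q (drop-∷-⊆ q⊆p)
∣p─q∣+∣q∣ (inside ∷ p) (inside ∷ q) q⊆p =
  trans (+-suc _ _) (cong suc (∣p─q∣+∣q∣ p q (drop-∷-⊆ q⊆p)))
∣p─q∣+∣q∣ (outside ∷ p) (inside ∷ q) q⊆p with q⊆p Vec.here
... | ()

∣p─q∣≡∣p∣∸∣q∣ : ∀ {n} (p q : Subset n) → q ⊆ p → ∣ p ─ q ∣ ≡ ∣ p ∣ ∸ ∣ q ∣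
∣p─q∣≡∣p∣∸∣q∣ p q q⊆p = trans (≡.sym (m+n∸n≡m ∣ p ─ q ∣ ∣ q ∣)) (cong (_∸ ∣ q ∣) (∣p─q∣+∣q∣ p q q⊆p))

missing-vertex : ∀ {n} (p : Subset n) → ∣ p ∣ < n → ∃[ w ] w ∉ p
missing-vertex {n} p ∣p∣<n with nonempty? (∁ p)
... | yes (w , w∈∁p) = w , x∈∁p⇒x∉p w∈∁p
... | no ∁p-empty = contradiction (subst (0 <_) n∸∣p∣≡0 (m<n⇒0<n∸m ∣p∣<n)) (n≮n 0)
  where
  n∸∣p∣≡0 : n ∸ ∣ p ∣ ≡ 0
  n∸∣p∣≡0 = trans (≡.sym (∣∁p∣≡n∸∣p∣ p)) (trans (cong ∣_∣ (Empty-unique ∁p-empty)) (∣⊥∣≡0 n))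

infix 4 _∈ₗ?_
_∈ₗ?_ : ∀ {n} (w : Fin n) (L : List (Fin n)) → Dec (w ∈ₗ L)
w ∈ₗ? L = any? (w Fin.≟_) L

∑-∈ₗ≤length : ∀ {n} (L : List (Fin n)) → ∑[ w < n ] 𝟙 (w ∈ₗ? L) ≤ length L
∑-∈ₗ≤length {n} [] = ≤-reflexive (sum-replicate-zero n)
∑-∈ₗ≤length {n} (a ∷ L) = begin
  ∑[ w < n ] 𝟙 (w ∈ₗ? a ∷ L)                    ≤⟨ sum-mono (λ w → 𝟙-⊎ (w Fin.≟ a) (w ∈ₗ? L)) ⟩
  ∑[ w < n ] (𝟙 (w Fin.≟ a) + 𝟙 (w ∈ₗ? L))       ≡⟨ ∑-distrib-+ (λ w → 𝟙 (w Fin.≟ a)) (λ w → 𝟙 (w ∈ₗ? L)) ⟩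
  ∑[ w < n ] 𝟙 (w Fin.≟ a) + ∑[ w < n ] 𝟙 (w ∈ₗ? L) ≡⟨ cong (_+ _) (∑-≡-indicator a) ⟩
  1 + ∑[ w < n ] 𝟙 (w ∈ₗ? L)                       ≤⟨ +-monoʳ-≤ 1 (∑-∈ₗ≤length L) ⟩
  suc (length L)                                    ∎
  where
  open ≤-Reasoning
  𝟙-⊎ : {P Q : Set} (p : Dec P) (q : Dec Q) → 𝟙 (p ⊎-dec q) ≤ 𝟙 p + 𝟙 q
  𝟙-⊎ (yes _) q = s≤s z≤n
  𝟙-⊎ (no _) q = ≤-refl

weighted-double-count :
  ∀ {n p q} (T : Subset n) (ℓ : Fin p → Fin q → List (Fin n)) (ω : Fin p → Fin q → ℕ) {m k} →
  (∀ i j → length (ℓ i j) ≤ k) →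
  (∀ w → w ∈ T → m ≤ ∑[ i < p ] ∑[ j < q ] (ω i j * 𝟙 (w ∈ₗ? ℓ i j))) →
  m * ∣ T ∣ ≤ (∑[ i < p ] ∑[ j < q ] ω i j) * k
weighted-double-count {n} {p} {q} T ℓ ω {m} {k} short covered = begin
  m * ∣ T ∣                                               ≡⟨ cong (m *_) (∣∣≡∑ T) ⟩
  m * ∑[ w < n ] 𝟙 (w ∈? T)                               ≡⟨ *-distribˡ-sum m (λ w → 𝟙 (w ∈? T)) ⟩
  ∑[ w < n ] (m * 𝟙 (w ∈? T))                             ≤⟨ sum-mono (λ w → weight-at w (w ∈? T)) ⟩
  ∑[ w < n ] ∑[ i < p ] ∑[ j < q ] occurrence i j w        ≡⟨ ∑-comm (λ w i → ∑[ j < q ] occurrence i j w) ⟩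
  ∑[ i < p ] ∑[ w < n ] ∑[ j < q ] occurrence i j w        ≡⟨ sum-cong-≗ (λ i → ∑-comm (λ w j → occurrence i j w)) ⟩
  ∑[ i < p ] ∑[ j < q ] ∑[ w < n ] occurrence i j w        ≡⟨ sum-cong-≗ (λ i → sum-cong-≗ (λ j → ≡.sym (*-distribˡ-sum (ω i j) (λ w → 𝟙 (w ∈ₗ? ℓ i j))))) ⟩
  ∑[ i < p ] ∑[ j < q ] (ω i j * ∑[ w < n ] 𝟙 (w ∈ₗ? ℓ i j)) ≤⟨ sum-mono (λ i → sum-mono (λ j → *-monoʳ-≤ (ω i j) (distinct≤k i j))) ⟩
  ∑[ i < p ] ∑[ j < q ] (ω i j * k)                         ≡⟨ sum-cong-≗ (λ i → ≡.sym (*-distribʳ-sum k (ω i))) ⟩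
  ∑[ i < p ] (∑[ j < q ] ω i j * k)                         ≡⟨ ≡.sym (*-distribʳ-sum k (λ i → ∑[ j < q ] ω i j)) ⟩
  (∑[ i < p ] ∑[ j < q ] ω i j) * k                         ∎
  where
  open ≤-Reasoning
  occurrence : Fin p → Fin q → Fin n → ℕ
  occurrence i j w = ω i j * 𝟙 (w ∈ₗ? ℓ i j)
  weight-at : ∀ w → Dec (w ∈ T) → m * 𝟙 (w ∈? T) ≤ ∑[ i < p ] ∑[ j < q ] occurrence i j w
  weight-at w (yes w∈T) rewrite 𝟙-yes (w ∈? T) w∈T | *-identityʳ m = covered w w∈T
  weight-at w (no w∉T) rewrite 𝟙-no (w ∈? T) w∉T | *-zeroʳ m = z≤n
  distinct≤k : ∀ i j → ∑[ w < n ] 𝟙 (w ∈ₗ? ℓ i j) ≤ k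
  distinct≤k i j = ≤-trans (∑-∈ₗ≤length (ℓ i j)) (short i j)

image : ∀ {n m} → (Fin n → Fin m) → Subset n → Subset m
image f T = tabulate (λ i → isYes (Fin.any? (λ w → w ∈? T ×-dec f w Fin.≟ i)))

module _ {n m : ℕ} (f : Fin n → Fin m) (T : Subset n) where

  ∈-image⁺ : ∀ {w} → w ∈ T → f w ∈ image f T
  ∈-image⁺ {w} w∈T = lookup⇒[]= (f w) (image f T)
    (trans (lookup∘tabulate _ (f w)) (Equivalence.to T-≡ (fromWitness (w , w∈T , refl))))

  ∈-image⁻ : ∀ {i} → i ∈ image f T → ∃[ w ] (w ∈ T × f w ≡ i)
  ∈-image⁻ {i} i∈ = toWitness {a? = Fin.any? (λ w → w ∈? T ×-dec f w Fin.≟ i)} (Equivalence.from T-≡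
    (trans (≡.sym (lookup∘tabulate _ i)) ([]=⇒lookup i∈)))

  ∣image∣≤ : ∣ image f T ∣ ≤ ∣ T ∣
  ∣image∣≤ = begin
    ∣ image f T ∣                                        ≡⟨ ∣∣≡∑ (image f T) ⟩
    ∑[ i < m ] 𝟙 (i ∈? image f T)                        ≤⟨ sum-mono (λ i → image-point i (i ∈? image f T)) ⟩
    ∑[ i < m ] ∑[ w < n ] (𝟙 (w ∈? T) * 𝟙 (i Fin.≟ f w)) ≡⟨ ∑-comm (λ i w → 𝟙 (w ∈? T) * 𝟙 (i Fin.≟ f w)) ⟩
    ∑[ w < n ] ∑[ i < m ] (𝟙 (w ∈? T) * 𝟙 (i Fin.≟ f w)) ≡⟨ sum-cong-≗ (λ w → ≡.sym (*-distribˡ-sum (𝟙 (w ∈? T)) (λ i → 𝟙 (i Fin.≟ f w)))) ⟩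
    ∑[ w < n ] (𝟙 (w ∈? T) * ∑[ i < m ] 𝟙 (i Fin.≟ f w)) ≡⟨ sum-cong-≗ (λ w → trans (cong (𝟙 (w ∈? T) *_) (∑-≡-indicator (f w))) (*-identityʳ _)) ⟩
    ∑[ w < n ] 𝟙 (w ∈? T)                                ≡⟨ ≡.sym (∣∣≡∑ T) ⟩
    ∣ T ∣                                                ∎
    where
    open ≤-Reasoning
    image-point : ∀ i → Dec (i ∈ image f T) → 𝟙 (i ∈? image f T) ≤ ∑[ w < n ] (𝟙 (w ∈? T) * 𝟙 (i Fin.≟ f w))
    image-point i (no i∉) rewrite 𝟙-no (i ∈? image f T) i∉ = z≤n
    image-point i (yes i∈) with ∈-image⁻ i∈
    ... | w , w∈T , refl rewrite 𝟙-yes (i ∈? image f T) i∈ =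
      subst (_≤ ∑[ v < n ] summand v) (cong₂ _*_ (𝟙-yes (w ∈? T) w∈T) (𝟙-yes (f w Fin.≟ f w) refl))
        (summand≤sum summand w)
      where
      summand : Fin n → ℕ
      summand v = 𝟙 (v ∈? T) * 𝟙 (f w Fin.≟ f v)

module _ {n : ℕ} (G : Graph n) where

  snoc : ∀ {x y z k} → Walk G x y k → Adj G y z → Walk G x z (suc k)
  snoc (stop x) y~z = step y~z (stop _)
  snoc (step x~u w) y~z = step x~u (snoc w y~z)

  verts-snoc : ∀ {x y z k} (w : Walk G x y k) (y~z : Adj G y z) → verts G (snoc w y~z) ≡ verts G w ∷ʳ z
  verts-snoc (stop x) y~z = refl
  verts-snoc (step {x} x~u w) y~z = cong (x ∷_) (verts-snoc w y~z)

  reverseWalk : ∀ {x y k} → Walk G x y k → Walk G y x k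
  reverseWalk (stop x) = stop x
  reverseWalk (step x~u w) = snoc (reverseWalk w) (Adj-sym G x~u)

  verts-reverseWalk : ∀ {x y k} (w : Walk G x y k) → verts G (reverseWalk w) ≡ reverse (verts G w)
  verts-reverseWalk (stop x) = refl
  verts-reverseWalk (step {x} x~u w) = begin
    verts G (snoc (reverseWalk w) (Adj-sym G x~u)) ≡⟨ verts-snoc (reverseWalk w) (Adj-sym G x~u) ⟩
    verts G (reverseWalk w) ∷ʳ x                   ≡⟨ cong (_∷ʳ x) (verts-reverseWalk w) ⟩
    reverse (verts G w) ∷ʳ x                       ≡⟨ ≡.sym (unfold-reverse x (verts G w)) ⟩
    reverse (x ∷ verts G w)                        ∎
    where open ≡-Reasoning

  start∈ : ∀ {x y k} (w : Walk G x y k) → x ∈ₗ verts G w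
  start∈ (stop x) = here refl
  start∈ (step x~u w) = here refl

  end∈ : ∀ {x y k} (w : Walk G x y k) → y ∈ₗ verts G w
  end∈ (stop x) = here refl
  end∈ (step x~u w) = there (end∈ w)

  allButLast : ∀ {x y k} → Walk G x y k → List (Fin n)
  allButLast (stop x) = []
  allButLast (step {x} x~u w) = x ∷ allButLast w

  interior : ∀ {x y k} → Walk G x y k → List (Fin n)
  interior (stop x) = []
  interior (step x~u w) = allButLast w

  length-allButLast : ∀ {x y k} (w : Walk G x y k) → length (allButLast w) ≡ k
  length-allButLast (stop x) = refl
  length-allButLast (step x~u w) = cong suc (length-allButLast w)

  length-interior : ∀ {x y k} (w : Walk G x y k) → length (interior w) ≡ k ∸ 1
  length-interior (stop x) = refl
  length-interior (step x~u w) = length-allButLast w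

  ∈-allButLast : ∀ {x y k t} (w : Walk G x y k) → t ∈ₗ verts G w → t ≡ y ⊎ t ∈ₗ allButLast w
  ∈-allButLast (stop x) (here t≡x) = inj₁ t≡x
  ∈-allButLast (step x~u w) (here t≡x) = inj₂ (here t≡x)
  ∈-allButLast (step x~u w) (there t∈w) = map₂ there (∈-allButLast w t∈w)

  ∈-interior : ∀ {x y k t} (w : Walk G x y k) → t ∈ₗ verts G w → t ≢ x → t ≢ y → t ∈ₗ interior w
  ∈-interior (stop x) (here t≡x) t≢x _ = contradiction t≡x t≢x
  ∈-interior (step x~u w) (here t≡x) t≢x _ = contradiction t≡x t≢x
  ∈-interior (step x~u w) (there t∈w) _ t≢y = [ (λ t≡y → contradiction t≡y t≢y) , (λ t∈ → t∈) ] (∈-allButLast w t∈w)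

  interior-vertex : ∀ {x y k} (w : Walk G x y k) → 2 ≤ k → (∀ m → Walk G x y m → k ≤ m) →
                    ∃[ z ] (z ≢ x × z ≢ y × z ∈ₗ verts G w)
  interior-vertex (stop _) () _
  interior-vertex (step _ (stop _)) (s≤s ()) _
  interior-vertex (step x~z (step z~u w)) _ shortest =
    _ , (λ { refl → Adj-irrefl G x~z }) , (λ { refl → too-short (shortest 1 (step x~z (stop _))) }) , there (here refl)
    where
    too-short : ∀ {k} → suc (suc k) ≤ 1 → ⊥
    too-short (s≤s ())

  reverseGeodesic : ∀ {x y} → Geodesic G x y → Geodesic G y x
  reverseGeodesic (geo k w shortest) = geo k (reverseWalk w) (λ m w′ → shortest m (reverseWalk w′))

  -- A geodesic from a vertex to itself is the trivial walk, so it reads the same backwards.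
  loop-palindrome : ∀ {x} (γ : Geodesic G x x) → verts G (walk γ) ≡ reverse (verts G (walk γ))
  loop-palindrome {x} γ = trivial (walk γ) (shortest γ 0 (stop x))
    where
    trivial : ∀ {k} (w : Walk G x x k) → k ≤ 0 → verts G w ≡ reverse (verts G w)
    trivial (stop x) _ = refl

  -- Orienting a family of geodesics along the order of Fin n: the x,y-path is γ x y when
  -- x ≤ y and the reverse of γ y x otherwise.  This makes g(y,x) the reverse of g(x,y).
  oriented : (∀ x y → Geodesic G x y) → ∀ x y → Geodesic G x y
  oriented γ x y with x Fin.≤? y
  ... | yes _ = γ x y
  ... | no _ = reverseGeodesic (γ y x)

  oriented-sym : (γ : ∀ x y → Geodesic G x y) → ∀ x y →
                 verts G (walk (oriented γ y x)) ≡ reverse (verts G (walk (oriented γ x y)))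
  oriented-sym γ x y with x Fin.≤? y | y Fin.≤? x
  ... | yes x≤y | yes y≤x with Fin.≤-antisym x≤y y≤x
  ...   | refl = loop-palindrome (γ x x)
  oriented-sym γ x y | yes _ | no _ = verts-reverseWalk (walk (γ x y))
  oriented-sym γ x y | no _ | yes _ =
    trans (≡.sym (reverse-involutive _)) (cong reverse (≡.sym (verts-reverseWalk (walk (γ y x)))))
  oriented-sym γ x y | no x≰y | no y≰x = ⊥-elim ([ x≰y , y≰x ] (Fin.≤-total x y))

  orientedChoice : (∀ x y → Geodesic G x y) → (S : Subset n) → PathChoice G S
  orientedChoice γ S = record { g = λ x y _ _ → oriented γ x y ; sym = λ x y _ _ → oriented-sym γ x y }

module _ {n : ℕ} (G : Graph n) {d : ℕ} (within : ∀ x y → ∃[ k ] (k ≤ d × Dist G x y k)) where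

  geodesics : ∀ x y → Geodesic G x y
  geodesics x y with within x y
  ... | k , _ , w , shortest = geo k w shortest

  len≤diam : ∀ {x y} (γ : Geodesic G x y) → len γ ≤ d
  len≤diam {x} {y} γ with within x y
  ... | k , k≤d , w , _ = ≤-trans (shortest γ k w) k≤d

∈-irrelevant : ∀ {n} {x : Fin n} {p : Subset n} (a b : x ∈ p) → a ≡ b
∈-irrelevant Vec.here Vec.here = refl
∈-irrelevant (Vec.there a) (Vec.there b) = cong Vec.there (∈-irrelevant a b)

module _ {n : ℕ} {G : Graph n} {S : Subset n} (P : PathChoice G S) where

  path : ∀ u v → u ∈ S → v ∈ S → List (Fin n)
  path u v u∈S v∈S = verts G (walk (g P u v u∈S v∈S))

  path-irrelevant : ∀ {u v} (u∈S u∈S′ : u ∈ S) (v∈S v∈S′ : v ∈ S) → path u v u∈S v∈S ≡ path u v u∈S′ v∈S′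
  path-irrelevant u∈S u∈S′ v∈S v∈S′ rewrite ∈-irrelevant u∈S u∈S′ | ∈-irrelevant v∈S v∈S′ = refl

  on-reversed-path : ∀ {w u v} (u∈S u∈S′ : u ∈ S) (v∈S v∈S′ : v ∈ S) →
                     w ∈ₗ path u v u∈S v∈S → w ∈ₗ path v u v∈S′ u∈S′
  on-reversed-path u∈S u∈S′ v∈S v∈S′ w∈ =
    subst (_ ∈ₗ_) (≡.sym (PathChoice.sym P _ _ u∈S′ v∈S′))
      (reverse⁺ (subst (_ ∈ₗ_) (path-irrelevant u∈S u∈S′ v∈S v∈S′) w∈))

module _ {n : ℕ} (G : Graph n) where

  -- Removing an interior vertex z of one oriented geodesic leaves a strong geodetic set:
  -- z stays on the path between the two ends, and every other vertex is the end of a path.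
  complement-of-interior : (γ : ∀ x y → Geodesic G x y) {x y z : Fin n} → x ≢ y → z ≢ x → z ≢ y →
                           z ∈ₗ verts G (walk (oriented G γ x y)) → StrongGeodetic G (∁ ⁅ z ⁆)
  complement-of-interior γ {x} {y} {z} x≢y z≢x z≢y z∈ = orientedChoice G γ (∁ ⁅ z ⁆) , cover
    where
    kept : ∀ {t} → t ≢ z → t ∈ ∁ ⁅ z ⁆
    kept t≢z = x∉p⇒x∈∁p (x≢y⇒x∉⁅y⁆ t≢z)
    cover : Covers G (∁ ⁅ z ⁆) (∁ ⁅ z ⁆) (λ t∈ → t∈) (orientedChoice G γ (∁ ⁅ z ⁆))
    cover t with t Fin.≟ z | t Fin.≟ x
    ... | yes refl | _ = x , y , kept (≢-sym z≢x) , kept (≢-sym z≢y) , x≢y , z∈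
    ... | no t≢z | yes refl = x , y , kept t≢z , kept (≢-sym z≢y) , x≢y , start∈ G (walk (oriented G γ x y))
    ... | no t≢z | no t≢x = t , x , kept t≢z , kept (≢-sym z≢x) , t≢x , start∈ G (walk (oriented G γ t x))

  -- If diam(G) ≥ 2, then sg(G) < n(G): a diametral geodesic has an interior vertex.
  sg<n : ∀ {d s} → Diam G d → 2 ≤ d → (∀ S → StrongGeodetic G S → s ≤ ∣ S ∣) → s < n
  sg<n {d} {s} (within , x , y , _ , x-y-shortest) 2≤d sg-min =
    let z , z≢x , z≢y , z∈ = interior-vertex G (walk γxy) (≤-trans 2≤d d≤len) (shortest γxy)
        s≤∣∁⁅z⁆∣ = sg-min (∁ ⁅ z ⁆) (complement-of-interior γ x≢y z≢x z≢y z∈)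
    in below x (≤-trans s≤∣∁⁅z⁆∣ (≤-reflexive (trans (∣∁p∣≡n∸∣p∣ ⁅ z ⁆) (cong (n ∸_) (∣⁅x⁆∣≡1 z)))))
    where
    γ : ∀ x y → Geodesic G x y
    γ = geodesics G within
    γxy : Geodesic G x y
    γxy = oriented G γ x y
    d≤len : d ≤ len γxy
    d≤len = x-y-shortest (len γxy) (walk γxy)
    x≢y : x ≢ y
    x≢y refl with ≤-trans 2≤d (x-y-shortest 0 (stop x))
    ... | ()
    below : ∀ {m} → Fin m → s ≤ m ∸ 1 → s < m
    below {suc m} _ s≤m = s≤s s≤m

  -- Dropping a vertex r from a strong geodetic set S leaves a core of S: a path from r
  -- is the reverse of the path towards r, whose other end is kept.
  drop-one-core : ∀ {S} r → StrongGeodetic G S → IsCore G S (S - r)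
  drop-one-core {S} r (P , cov) = p─q⊆p S ⁅ r ⁆ , P , cover
    where
    cover : Covers G S (S - r) (p─q⊆p S ⁅ r ⁆) P
    cover t with cov t
    ... | u , v , u∈S , v∈S , u≢v , t∈ with u Fin.≟ r
    ...   | no u≢r = u , v , x∈p∧x≢y⇒x∈p-y u∈S u≢r , v∈S , u≢v , subst (t ∈ₗ_) (path-irrelevant P _ _ _ _) t∈
    ...   | yes refl = v , u , x∈p∧x≢y⇒x∈p-y v∈S (≢-sym u≢v) , u∈S , ≢-sym u≢v , on-reversed-path P _ _ _ _ t∈

  -- Let U w be the first end of the path covering w.  The image of the complement of S
  -- under U is a core of S of size at most |V ∖ S|: vertices outside S are covered by their
  -- own path, vertices of the image by a path starting there, and the remaining vertices
  -- of S by the path to them from U w₀, for a fixed w₀ ∉ S.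
  image-core : ∀ {S w₀} → StrongGeodetic G S → w₀ ∉ S → ∃[ X ] (IsCore G S X × ∣ X ∣ ≤ ∣ ∁ S ∣)
  image-core {S} {w₀} (P , cov) w₀∉S = X , (X⊆S , P , cover) , ∣image∣≤ U (∁ S)
    where
    U : Fin n → Fin n
    U w = proj₁ (cov w)
    V : Fin n → Fin n
    V w = proj₁ (proj₂ (cov w))
    U∈S : ∀ w → U w ∈ S
    U∈S w = proj₁ (proj₂ (proj₂ (cov w)))
    V∈S : ∀ w → V w ∈ S
    V∈S w = proj₁ (proj₂ (proj₂ (proj₂ (cov w))))
    U≢V : ∀ w → U w ≢ V w
    U≢V w = proj₁ (proj₂ (proj₂ (proj₂ (proj₂ (cov w)))))
    on-path : ∀ w → w ∈ₗ path P (U w) (V w) (U∈S w) (V∈S w)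
    on-path w = proj₂ (proj₂ (proj₂ (proj₂ (proj₂ (cov w)))))
    X : Subset n
    X = image U (∁ S)
    X⊆S : X ⊆ S
    X⊆S u∈X with ∈-image⁻ U (∁ S) u∈X
    ... | w , _ , refl = U∈S w
    U∈X : ∀ {w} → w ∉ S → U w ∈ X
    U∈X w∉S = ∈-image⁺ U (∁ S) (x∉p⇒x∈∁p w∉S)
    cover : Covers G S X X⊆S P
    cover t with t ∈? S
    ... | no t∉S = U t , V t , U∈X t∉S , V∈S t , U≢V t , subst (t ∈ₗ_) (path-irrelevant P _ _ _ _) (on-path t)
    ... | yes t∈S with t ∈? X
    ...   | yes t∈X with ∈-image⁻ U (∁ S) t∈X
    ...     | w , w∈∁S , refl = U w , V w , U∈X (x∈∁p⇒x∉p w∈∁S) , V∈S w , U≢V w , start∈ G (walk (g P _ _ _ _))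
    cover t | yes t∈S | no t∉X =
      U w₀ , t , U∈X w₀∉S , t∈S , (λ { refl → t∉X (U∈X w₀∉S) }) , end∈ G (walk (g P _ _ _ _))

  -- A minimum core of a strong geodetic set S is smaller than S (remove any vertex of S).
  sgc<∣S∣ : ∀ {S c} → StrongGeodetic G S → Fin n → (∀ Y → IsCore G S Y → c ≤ ∣ Y ∣) → c < ∣ S ∣
  sgc<∣S∣ {S} sg x sgc-min =
    let r , _ , r∈S , _ = proj₂ sg x
    in <-≤-trans (s≤s (sgc-min (S - r) (drop-one-core r sg))) (x∈p⇒∣p-x∣<∣p∣ r∈S)

  sgc+∣S∣≤n : ∀ {S c} → StrongGeodetic G S → ∣ S ∣ < n → (∀ Y → IsCore G S Y → c ≤ ∣ Y ∣) → c + ∣ S ∣ ≤ n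
  sgc+∣S∣≤n {S} {c} sg ∣S∣<n sgc-min =
    let w₀ , w₀∉S = missing-vertex S ∣S∣<n
        Y , Y-core , ∣Y∣≤∣∁S∣ = image-core sg w₀∉S
        c≤n∸∣S∣ = ≤-trans (sgc-min Y Y-core) (≤-trans ∣Y∣≤∣∁S∣ (≤-reflexive (∣∁p∣≡n∸∣p∣ S)))
    in ≤-trans (+-monoˡ-≤ ∣ S ∣ c≤n∸∣S∣) (≤-reflexive (m∸n+n≡m (<⇒≤ ∣S∣<n)))

-- Let X be a core of S.  Weight an ordered pair (u,v) with u ∈ X by
-- [v ∈ S - u] + [v ∈ S ∖ X]; the total weight is |X|·((|S| - 1) + (|S| - |X|)).  Every
-- vertex outside S is an interior vertex of a chosen path g(u,v) with u ∈ X, hence is met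
-- with weight at least 2: by (u,v) with weight 2 if v ∉ X, and by (u,v) and (v,u) otherwise.
-- Each chosen path has at most d - 1 interior vertices, so double counting gives
--   2·|V ∖ S| ≤ |X|·((|S| - 1) + (|S| - |X|))·(d - 1).
module Counting {n : ℕ} (G : Graph n) {S X : Subset n} (X⊆S : X ⊆ S)
                (P : PathChoice G S) (cov : Covers G S X X⊆S P) where

  inner : Fin n → Fin n → List (Fin n)
  inner u v with u ∈? S | v ∈? S
  ... | yes u∈S | yes v∈S = interior G (walk (g P u v u∈S v∈S))
  ... | _ | _ = []

  inner-short : ∀ {d} → (∀ {x y} (γ : Geodesic G x y) → len γ ≤ d) → ∀ u v → length (inner u v) ≤ d ∸ 1
  inner-short len≤d u v with u ∈? S | v ∈? S
  ... | yes u∈S | yes v∈S =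
    ≤-trans (≤-reflexive (length-interior G (walk (g P u v u∈S v∈S)))) (∸-monoˡ-≤ 1 (len≤d (g P u v u∈S v∈S)))
  ... | yes _ | no _ = z≤n
  ... | no _ | _ = z≤n

  ∈-inner : ∀ {w u v} (u∈S : u ∈ S) (v∈S : v ∈ S) → w ∉ S → w ∈ₗ path P u v u∈S v∈S → w ∈ₗ inner u v
  ∈-inner {w} {u} {v} u∈S v∈S w∉S w∈ with u ∈? S | v ∈? S
  ... | yes u∈S′ | yes v∈S′ =
    ∈-interior G (walk (g P u v u∈S′ v∈S′)) (subst (w ∈ₗ_) (path-irrelevant P u∈S u∈S′ v∈S v∈S′) w∈)
      (λ { refl → w∉S u∈S }) (λ { refl → w∉S v∈S })
  ... | no u∉S | _ = contradiction u∈S u∉S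
  ... | yes _ | no v∉S = contradiction v∈S v∉S

  weight : Fin n → Fin n → ℕ
  weight u v = 𝟙 (u ∈? X) * (𝟙 (v ∈? S - u) + 𝟙 (v ∈? S ─ X))

  total-weight : ∑[ u < n ] ∑[ v < n ] weight u v ≡ ∣ X ∣ * ((∣ S ∣ ∸ 1) + (∣ S ∣ ∸ ∣ X ∣))
  total-weight = begin
    ∑[ u < n ] ∑[ v < n ] weight u v   ≡⟨ sum-cong-≗ row ⟩
    ∑[ u < n ] (𝟙 (u ∈? X) * K)        ≡⟨ ≡.sym (*-distribʳ-sum K (λ u → 𝟙 (u ∈? X))) ⟩
    (∑[ u < n ] 𝟙 (u ∈? X)) * K        ≡⟨ cong (_* K) (≡.sym (∣∣≡∑ X)) ⟩
    ∣ X ∣ * K                          ∎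
    where
    open ≡-Reasoning
    K : ℕ
    K = (∣ S ∣ ∸ 1) + (∣ S ∣ ∸ ∣ X ∣)
    row-size : ∀ u → u ∈ X → ∣ S - u ∣ + ∣ S ─ X ∣ ≡ K
    row-size u u∈X = cong₂ _+_
      (trans (∣p─q∣≡∣p∣∸∣q∣ S ⁅ u ⁆ (λ t∈⁅u⁆ → subst (_∈ S) (≡.sym (x∈⁅y⁆⇒x≡y u t∈⁅u⁆)) (X⊆S u∈X)))
             (cong (∣ S ∣ ∸_) (∣⁅x⁆∣≡1 u)))
      (∣p─q∣≡∣p∣∸∣q∣ S X X⊆S)
    row : ∀ u → ∑[ v < n ] weight u v ≡ 𝟙 (u ∈? X) * K
    row u with u ∈? X
    ... | no _ = sum-replicate-zero n
    ... | yes u∈X = begin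
      ∑[ v < n ] (1 * (𝟙 (v ∈? S - u) + 𝟙 (v ∈? S ─ X)))          ≡⟨ sum-cong-≗ (λ v → *-identityˡ (𝟙 (v ∈? S - u) + 𝟙 (v ∈? S ─ X))) ⟩
      ∑[ v < n ] (𝟙 (v ∈? S - u) + 𝟙 (v ∈? S ─ X))                ≡⟨ ∑-distrib-+ (λ v → 𝟙 (v ∈? S - u)) (λ v → 𝟙 (v ∈? S ─ X)) ⟩
      ∑[ v < n ] 𝟙 (v ∈? S - u) + ∑[ v < n ] 𝟙 (v ∈? S ─ X)      ≡⟨ ≡.sym (cong₂ _+_ (∣∣≡∑ (S - u)) (∣∣≡∑ (S ─ X))) ⟩
      ∣ S - u ∣ + ∣ S ─ X ∣                                        ≡⟨ row-size u u∈X ⟩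
      K                                                            ≡⟨ ≡.sym (*-identityˡ K) ⟩
      1 * K                                                        ∎

  meets : Fin n → Fin n → Fin n → ℕ
  meets w u v = weight u v * 𝟙 (w ∈ₗ? inner u v)

  meets-pair : ∀ {w u v} → u ∈ X → v ∈ S → u ≢ v → w ∈ₗ inner u v → 1 ≤ meets w u v
  meets-pair {w} {u} {v} u∈X v∈S u≢v w∈
    rewrite 𝟙-yes (u ∈? X) u∈X | 𝟙-yes (v ∈? S - u) (x∈p∧x≢y⇒x∈p-y v∈S (≢-sym u≢v)) | 𝟙-yes (w ∈ₗ? inner u v) w∈
    = s≤s z≤n

  meets-pair-outside : ∀ {w u v} → u ∈ X → v ∈ S → u ≢ v → v ∉ X → w ∈ₗ inner u v → 2 ≤ meets w u v
  meets-pair-outside {w} {u} {v} u∈X v∈S u≢v v∉X w∈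
    rewrite 𝟙-yes (u ∈? X) u∈X | 𝟙-yes (v ∈? S - u) (x∈p∧x≢y⇒x∈p-y v∈S (≢-sym u≢v))
          | 𝟙-yes (v ∈? S ─ X) (x∈p∧x∉q⇒x∈p─q v∈S v∉X) | 𝟙-yes (w ∈ₗ? inner u v) w∈
    = s≤s (s≤s z≤n)

  met-twice : ∀ w → w ∈ ∁ S → 2 ≤ ∑[ u < n ] ∑[ v < n ] meets w u v
  met-twice w w∈∁S with cov w
  ... | u , v , u∈X , v∈S , u≢v , w∈ with v ∈? X
  ...   | no v∉X = begin
    2                                    ≤⟨ meets-pair-outside u∈X v∈S u≢v v∉X w∈inner ⟩
    meets w u v                          ≤⟨ summand≤sum (meets w u) v ⟩
    ∑[ v′ < n ] meets w u v′             ≤⟨ summand≤sum (λ u′ → ∑[ v′ < n ] meets w u′ v′) u ⟩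
    ∑[ u′ < n ] ∑[ v′ < n ] meets w u′ v′ ∎
    where
    open ≤-Reasoning
    w∈inner : w ∈ₗ inner u v
    w∈inner = ∈-inner (X⊆S u∈X) v∈S (x∈∁p⇒x∉p w∈∁S) w∈
  ...   | yes v∈X = begin
    2                                                      ≤⟨ +-mono-≤ (meets-pair u∈X v∈S u≢v w∈inner) (meets-pair v∈X u∈S (≢-sym u≢v) w∈inner′) ⟩
    meets w u v + meets w v u                              ≤⟨ +-mono-≤ (summand≤sum (meets w u) v) (summand≤sum (meets w v) u) ⟩
    ∑[ v′ < n ] meets w u v′ + ∑[ v′ < n ] meets w v v′    ≤⟨ two-summands≤sum (λ u′ → ∑[ v′ < n ] meets w u′ v′) u≢v ⟩
    ∑[ u′ < n ] ∑[ v′ < n ] meets w u′ v′                   ∎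
    where
    open ≤-Reasoning
    u∈S : u ∈ S
    u∈S = X⊆S u∈X
    w∉S : w ∉ S
    w∉S = x∈∁p⇒x∉p w∈∁S
    w∈inner : w ∈ₗ inner u v
    w∈inner = ∈-inner u∈S v∈S w∉S w∈
    w∈inner′ : w ∈ₗ inner v u
    w∈inner′ = ∈-inner (X⊆S v∈X) u∈S w∉S (on-reversed-path P u∈S u∈S v∈S (X⊆S v∈X) w∈)

  count : ∀ {d} → (∀ {x y} (γ : Geodesic G x y) → len γ ≤ d) →
          2 * (n ∸ ∣ S ∣) ≤ ∣ X ∣ * ((∣ S ∣ ∸ 1) + (∣ S ∣ ∸ ∣ X ∣)) * (d ∸ 1)
  count {d} len≤d = subst₂ (λ m total → 2 * m ≤ total * (d ∸ 1)) (∣∁p∣≡n∸∣p∣ S) total-weight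
    (weighted-double-count (∁ S) inner weight (inner-short len≤d) met-twice)

switch-on : ∀ (P : ℕ → Set) → Decidable P → ∀ {c} → ¬ P 0 → P c → ∃[ b ] (1 ≤ b × b ≤ c × P b × ¬ P (b ∸ 1))
switch-on P P? {zero} ¬P0 P0 = contradiction P0 ¬P0
switch-on P P? {suc c} ¬P0 Pc+1 with P? c
... | no ¬Pc = suc c , s≤s z≤n , ≤-refl , Pc+1 , ¬Pc
... | yes Pc with switch-on P P? ¬P0 Pc
...   | b , 1≤b , b≤c , Pb , ¬Pb-1 = b , 1≤b , m≤n⇒m≤1+n b≤c , Pb , ¬Pb-1

pos-∸ : ∀ {m n} → n ≤ m → + (m ∸ n) ≡ + m ℤ.- + n
pos-∸ {m} {n} n≤m = ≡.sym (trans (ℤP.m-n≡m⊖n m n) (ℤP.⊖-≥ n≤m))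

ceilArg : ℕ → ℤ → ℤ
ceilArg s k = + (2 * s) ℤ.- (+ 2) ℤ.* k ℤ.- + 1

-- Since (2s-1)² - (2s-2k-1)² = 4k(2s-1-k):
--   (d-1)·D - (d-1)(2s-2k-1)² = 4·(k(2s-1-k)(d-1) - 2(n-s)).
D'-gap : ∀ s n d k → D' s n d ℤ.- + (d ∸ 1) ℤ.* (ceilArg s k ℤ.* ceilArg s k)
                     ≡ + 4 ℤ.* (k ℤ.* (+ (2 * s) ℤ.- + 1 ℤ.- k) ℤ.* + (d ∸ 1) ℤ.- + 2 ℤ.* (+ n ℤ.- + s))
D'-gap s n d k = gap (+ (d ∸ 1)) (+ (2 * s)) k (+ n ℤ.- + s)
  where
  gap : ∀ e A k N → (e ℤ.* ((A ℤ.- + 1) ℤ.* (A ℤ.- + 1)) ℤ.- + 8 ℤ.* N) ℤ.- e ℤ.* ((A ℤ.- + 2 ℤ.* k ℤ.- + 1) ℤ.* (A ℤ.- + 2 ℤ.* k ℤ.- + 1))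
                  ≡ + 4 ℤ.* (k ℤ.* (A ℤ.- + 1 ℤ.- k) ℤ.* e ℤ.- + 2 ℤ.* N)
  gap = solve-∀

0≤e*x² : ∀ e x → + 0 ℤ.≤ + e ℤ.* (x ℤ.* x)
0≤e*x² e x = subst (ℤ._≤ + e ℤ.* (x ℤ.* x)) (ℤP.*-zeroʳ (+ e)) (ℤP.*-monoˡ-≤-nonNeg (+ e) (square≥0 x))
  where
  square≥0 : ∀ x → + 0 ℤ.≤ x ℤ.* x
  square≥0 (+ m) = subst (+ 0 ℤ.≤_) (ℤP.pos-* m m) (ℤ.+≤+ z≤n)
  square≥0 ℤ.-[1+ m ] = ℤ.+≤+ z≤n

-- "2s - 2k - 1 ≤ √D", the condition whose least solution k is the ceiling.
Reaches : ℕ → ℕ → ℕ → ℕ → Set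
Reaches s n d k = LeSqrtD s n d (ceilArg s (+ k))

reaches? : ∀ s n d → Decidable (Reaches s n d)
reaches? s n d k = (ceilArg s (+ k) ℤP.<? + 0) ⊎-dec (+ (d ∸ 1) ℤ.* (ceilArg s (+ k) ℤ.* ceilArg s (+ k)) ℤP.≤? D' s n d)

counting-ℤ : ∀ {s n} d {c} → c < s → s < n → 2 * (n ∸ s) ≤ c * ((s ∸ 1) + (s ∸ c)) * (d ∸ 1) →
             + 2 ℤ.* (+ n ℤ.- + s) ℤ.≤ + c ℤ.* (+ (2 * s) ℤ.- + 1 ℤ.- + c) ℤ.* + (d ∸ 1)
counting-ℤ {s} {n} d {c} c<s s<n counting = subst₂ ℤ._≤_ lhs rhs (ℤ.+≤+ counting)
  where
  lhs : + (2 * (n ∸ s)) ≡ + 2 ℤ.* (+ n ℤ.- + s)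
  lhs = trans (ℤP.pos-* 2 (n ∸ s)) (cong (+ 2 ℤ.*_) (pos-∸ (<⇒≤ s<n)))
  regroup : ∀ σ γ → (σ ℤ.- + 1) ℤ.+ (σ ℤ.- γ) ≡ + 2 ℤ.* σ ℤ.- + 1 ℤ.- γ
  regroup = solve-∀
  middle : + ((s ∸ 1) + (s ∸ c)) ≡ + (2 * s) ℤ.- + 1 ℤ.- + c
  middle = begin
    + ((s ∸ 1) + (s ∸ c))               ≡⟨ ℤP.pos-+ (s ∸ 1) (s ∸ c) ⟩
    + (s ∸ 1) ℤ.+ + (s ∸ c)             ≡⟨ cong₂ ℤ._+_ (pos-∸ (≤-trans (s≤s z≤n) c<s)) (pos-∸ (<⇒≤ c<s)) ⟩
    (+ s ℤ.- + 1) ℤ.+ (+ s ℤ.- + c)     ≡⟨ regroup (+ s) (+ c) ⟩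
    + 2 ℤ.* + s ℤ.- + 1 ℤ.- + c         ≡⟨ cong (λ t → t ℤ.- + 1 ℤ.- + c) (≡.sym (ℤP.pos-* 2 s)) ⟩
    + (2 * s) ℤ.- + 1 ℤ.- + c           ∎
    where open ≡-Reasoning
  rhs : + (c * ((s ∸ 1) + (s ∸ c)) * (d ∸ 1)) ≡ + c ℤ.* (+ (2 * s) ℤ.- + 1 ℤ.- + c) ℤ.* + (d ∸ 1)
  rhs = trans (ℤP.pos-* (c * ((s ∸ 1) + (s ∸ c))) (d ∸ 1))
              (cong (ℤ._* + (d ∸ 1)) (trans (ℤP.pos-* c _) (cong (+ c ℤ.*_) middle)))

reaches-at-count : ∀ {s n} d {c} → c < s → s < n → 2 * (n ∸ s) ≤ c * ((s ∸ 1) + (s ∸ c)) * (d ∸ 1) →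
                   + (d ∸ 1) ℤ.* (ceilArg s (+ c) ℤ.* ceilArg s (+ c)) ℤ.≤ D' s n d
reaches-at-count {s} {n} d {c} c<s s<n counting =
  ℤP.0≤i-j⇒j≤i (subst (+ 0 ℤ.≤_) (≡.sym (D'-gap s n d (+ c)))
    (ℤP.*-monoˡ-≤-nonNeg (+ 4) (ℤP.i≤j⇒0≤j-i (counting-ℤ d c<s s<n counting))))

-- At k = 0 the condition fails: 2s - 1 ≥ 0, and (d-1)·D - (d-1)(2s-1)² = -8(n-s) < 0.
¬reaches-0 : ∀ {s n} d → 0 < s → s < n → ¬ Reaches s n d 0
¬reaches-0 {s} {n} d 0<s s<n (inj₁ x₀<0) = ℤP.<⇒≱ x₀<0 (subst (+ 0 ℤ.≤_) x₀≡ (ℤ.+≤+ z≤n))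
  where
  drop-zero : ∀ A → A ℤ.- + 2 ℤ.* + 0 ℤ.- + 1 ≡ A ℤ.- + 1
  drop-zero = solve-∀
  x₀≡ : + (2 * s ∸ 1) ≡ ceilArg s (+ 0)
  x₀≡ = trans (pos-∸ (≤-trans 0<s (m≤m+n s (s + 0)))) (≡.sym (drop-zero (+ (2 * s))))
¬reaches-0 {s} {n} d 0<s s<n (inj₂ reaches) =
  ℤP.<⇒≱ gap<0 (subst (+ 0 ℤ.≤_) (D'-gap s n d (+ 0)) (ℤP.i≤j⇒0≤j-i reaches))
  where
  gap-at-0 : ∀ A e N → + 4 ℤ.* (+ 0 ℤ.* (A ℤ.- + 1 ℤ.- + 0) ℤ.* e ℤ.- + 2 ℤ.* N) ≡ ℤ.- (+ 8 ℤ.* N)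
  gap-at-0 = solve-∀
  -8m<0 : ∀ m → 0 < m → ℤ.- (+ 8 ℤ.* + m) ℤ.< + 0
  -8m<0 (suc m) _ = ℤ.-<+
  gap<0 : + 4 ℤ.* (+ 0 ℤ.* (+ (2 * s) ℤ.- + 1 ℤ.- + 0) ℤ.* + (d ∸ 1) ℤ.- + 2 ℤ.* (+ n ℤ.- + s)) ℤ.< + 0
  gap<0 = subst (ℤ._< + 0)
    (≡.sym (trans (gap-at-0 (+ (2 * s)) (+ (d ∸ 1)) (+ n ℤ.- + s)) (cong (λ t → ℤ.- (+ 8 ℤ.* t)) (≡.sym (pos-∸ (<⇒≤ s<n))))))
    (-8m<0 (n ∸ s) (m<n⇒0<n∸m s<n))

-- The counting inequality at c, together with c < s < n, places the ceiling
-- ⌈s - (1+√D)/2⌉ in [1, c]: the condition "2s-2k-1 ≤ √D" fails at k = 0, holds at k = c,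
-- and the ceiling is where it switches on.
ceiling-bound : ∀ {s n} d {c} → c < s → s < n → 2 * (n ∸ s) ≤ c * ((s ∸ 1) + (s ∸ c)) * (d ∸ 1) →
                ∃[ b ] (IsCeilBound s n d b × + 1 ℤ.≤ b × b ℤ.≤ + c)
ceiling-bound {s} {n} d {c} c<s s<n counting =
  let b , 1≤b , b≤c , reaches-b , ¬reaches-b-1 =
        switch-on (Reaches s n d) (reaches? s n d) (¬reaches-0 d (≤-trans (s≤s z≤n) c<s) s<n) (inj₂ reaches-c)
  in + b , (D'≥0 , reaches-b , subst (λ k → ¬ LeSqrtD s n d (ceilArg s k)) (pos-∸ 1≤b) ¬reaches-b-1)
     , ℤ.+≤+ 1≤b , ℤ.+≤+ b≤c
  where
  reaches-c : + (d ∸ 1) ℤ.* (ceilArg s (+ c) ℤ.* ceilArg s (+ c)) ℤ.≤ D' s n d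
  reaches-c = reaches-at-count d c<s s<n counting
  D'≥0 : + 0 ℤ.≤ D' s n d
  D'≥0 = ℤP.≤-trans (0≤e*x² (d ∸ 1) (ceilArg s (+ c))) reaches-c

theorem3p2 : ∀ (n : ℕ) (G : Graph n) → Connected G →
             ∀ (s d c : ℕ) → SG G s → Diam G d → 2 ≤ d → SGC G c →
             ∃[ b ] (IsCeilBound s n d b × (+ 1) ℤ.≤ b × b ℤ.≤ + c
                     × c + 1 ≤ s × c + s ≤ n)
theorem3p2 n G _ s d c ((S₀ , (sgS₀ , _) , ∣S₀∣≡s) , sg-min) diam@(within , x , _) 2≤d
           ((S , X , (sgS , S-min) , (X⊆S , P , cov) , ∣X∣≡c) , sgc-min) =
  let b , ceiling , 1≤b , b≤c = ceiling-bound d c<s s<n counting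
  in b , ceiling , 1≤b , b≤c , subst (_≤ s) (+-comm 1 c) c<s , c+s≤n
  where
  ∣S∣≡s : ∣ S ∣ ≡ s
  ∣S∣≡s = ≤-antisym (subst (∣ S ∣ ≤_) ∣S₀∣≡s (S-min S₀ sgS₀)) (sg-min S sgS)
  sgc≤ : ∀ Y → IsCore G S Y → c ≤ ∣ Y ∣
  sgc≤ Y = sgc-min S Y (sgS , S-min)
  s<n : s < n
  s<n = sg<n G diam 2≤d sg-min
  c<s : c < s
  c<s = subst (c <_) ∣S∣≡s (sgc<∣S∣ G sgS x sgc≤)
  c+s≤n : c + s ≤ n
  c+s≤n = subst (λ t → c + t ≤ n) ∣S∣≡s (sgc+∣S∣≤n G sgS (subst (_< n) (≡.sym ∣S∣≡s) s<n) sgc≤)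
  counting : 2 * (n ∸ s) ≤ c * ((s ∸ 1) + (s ∸ c)) * (d ∸ 1)
  counting = subst₂ (λ t k → 2 * (n ∸ t) ≤ k * ((t ∸ 1) + (t ∸ k)) * (d ∸ 1)) ∣S∣≡s ∣X∣≡c
               (Counting.count G X⊆S P cov (len≤diam G within))
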